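{- Let $n\ge1$. The subsemigroup complex ${\cal H}(B(n))$ is a matroid if and only if $n\le 3$.
   Context: For $n\ge1$, $B(n)$ denotes the aperiodic Brandt semigroup: the set $(\{1,\dots,n\}\times\{1,\dots,n\})\cup\{0\}$, where $0$ is a zero element and $(i,j)(k,l)=(i,l)$ if $j=k$ and $(i,j)(k,l)=0$ otherwise. For a finite nonempty semigroup $S$ and $Y\subseteq S$, $Y^+$ denotes the subsemigroup generated by $Y$ (with $\emptyset^+=\emptyset$). The subsemigroup complex ${\cal H}(S)=(S,H(S))$ is the simplicial complex with vertex set $S$ whose faces are the subsets $X\subseteq S$ admitting an enumeration $x_1,\dots,x_k$ such that $\emptyset\subset\{x_1\}^+\subset\{x_1,x_2\}^+\subset\cdots\subset\{x_1,\dots,x_k\}^+$ with all inclusions strict. A simplicial complex $(A,H)$ is a matroid if it satisfies the exchange property: for all faces $I,J\in H$ with $|I|=|J|+1$ there exists $p\in I\setminus J$ with $J\cup\{p\}\in H$. -}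

module Defs where

open import Data.Nat using (ℕ; suc)
open import Data.Fin using (Fin; _≟_)
open import Data.Maybe using (Maybe; just; nothing)
open import Data.Product using (_×_; _,_; ∃; ∃-syntax)
open import Data.List using (List; []; _∷_; length; take)
open import Data.List.Membership.Propositional using (_∈_; _∉_)
open import Data.List.Relation.Unary.Unique.Propositional using (Unique)
open import Data.List.Relation.Binary.Permutation.Propositional using (_↭_)
open import Relation.Nullary using (¬_; yes; no)
open import Relation.Binary.PropositionalEquality using (_≡_)
open import Level using (0ℓ)

-- The aperiodic Brandt semigroup B(n):
-- carrier ({1..n} × {1..n}) ∪ {0}, with 0 represented by `nothing`
-- and the pair (i , j) by `just (i , j)`.

BElt : ℕ → Set
BElt n = Maybe (Fin n × Fin n)

bmul : ∀ {n} → BElt n → BElt n → BElt n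
bmul nothing        _                = nothing
bmul (just _)       nothing          = nothing
bmul (just (i , j)) (just (k , l)) with j ≟ k
... | yes _ = just (i , l)
... | no  _ = nothing

-- Subsemigroup generated by a (finite) set Y, given as a list:
-- Y⁺ is the set of all finite nonempty products of elements of Y.
-- (Y = [] gives the empty set.)

module _ {A : Set} (_·_ : A → A → A) where

  data Gen (Y : List A) : A → Set where
    base : ∀ {y} → y ∈ Y → Gen Y y
    mul  : ∀ {a b} → Gen Y a → Gen Y b → Gen Y (a · b)

  _⊂_ : (A → Set) → (A → Set) → Set
  P ⊂ Q = (∀ a → P a → Q a) × (∃[ a ] (Q a × ¬ P a))

  -- x₁ … x_k satisfies  ∅ ⊂ {x₁}⁺ ⊂ {x₁,x₂}⁺ ⊂ … ⊂ {x₁,…,x_k}⁺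
  StrictChain : List A → Set
  StrictChain L = ∀ (i : Fin (length L)) →
    Gen (take (Data.Fin.toℕ i) L) ⊂ Gen (take (suc (Data.Fin.toℕ i)) L)

  -- A finite subset X ⊆ S (a duplicate-free list, read up to order)
  -- is a face of the subsemigroup complex H(S) iff it admits an
  -- enumeration forming a strict chain.
  IsFace : List A → Set
  IsFace X = Unique X × ∃[ L ] (L ↭ X × StrictChain L)

  IsMatroid : Set
  IsMatroid = ∀ (I J : List A) → IsFace I → IsFace J →
    length I ≡ suc (length J) →
    ∃[ p ] (p ∈ I × p ∉ J × IsFace (p ∷ J))

HBIsMatroid : ℕ → Set
HBIsMatroid n = IsMatroid (bmul {n})

module Submission where

-- Chains: (i) every duplicate-free subset of a chain is a face, because
--   filtering a chain keeps it a chain; (ii) no face contains a nonempty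
--   redundant set S (each element generated by the others), since the last
--   element of S in a chain enumeration would already be generated.
-- Theorem: for n ≤ 2 all of B(n) is a chain, so H(B(n)) is free; for n = 3
--   the off-diagonal elements D are redundant and B(3) minus any e ∈ D is a
--   chain, so the faces are the sets missing part of D; for n ≥ 4 explicit
--   faces I, J with |I| = |J| + 1 violate exchange.

open import Defs
open import Data.Nat using (ℕ; zero; suc; _≤_; _<_; _<?_; s≤s; z≤n)
open import Data.Nat.Properties using (≤-reflexive; ≤-trans; 1+n≰n)
open import Data.Bool using (true; false)
open import Data.Unit using (⊤; tt)
open import Data.Empty using (⊥-elim)
open import Data.Sum using (_⊎_; inj₁; inj₂)
open import Data.Product using (_×_; _,_; proj₁; proj₂; ∃-syntax)
import Data.Product.Properties as Product
open import Data.Fin using (Fin; toℕ; #_)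
import Data.Fin as Fin
open import Data.Maybe using (just; nothing)
import Data.Maybe.Properties as Maybe
open import Data.List
  using (List; []; _∷_; _++_; [_]; _∷ʳ_; length; take; map; filter; deduplicate;
         cartesianProduct; cartesianProductWith; allFin)
open import Data.List.Properties using (++-assoc; ++-identityʳ)
open import Data.List.Membership.Propositional using (_∈_; _∉_; find)
import Data.List.Membership.DecPropositional as DecMembership
open import Data.List.Membership.Propositional.Properties
  using (∈-++⁺ˡ; ∈-++⁺ʳ; ∈-++⁻; ∈-∃++; ∈-map⁺; ∈-map⁻; ∈-filter⁺; ∈-filter⁻;
         ∈-deduplicate⁺; ∈-deduplicate⁻; ∈-cartesianProduct⁺;
         ∈-cartesianProductWith⁻; ∈-allFin)
open import Data.List.Membership.Propositional.Properties.WithK using (unique∧set⇒bag)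
open import Data.List.Relation.Binary.BagAndSetEquality using (∼bag⇒↭)
open import Data.List.Relation.Binary.Subset.Propositional using (_⊆_)
open import Data.List.Relation.Binary.Subset.Propositional.Properties using (++⁺ˡ)
open import Data.List.Relation.Binary.Permutation.Propositional using (↭-refl; ↭-sym)
open import Data.List.Relation.Binary.Permutation.Propositional.Properties using (∈-resp-↭)
open import Data.List.Relation.Unary.Any using (here; there)
open import Data.List.Relation.Unary.All as All using (All; all?)
open import Data.List.Relation.Unary.All.Properties using (¬Any⇒All¬; ¬All⇒Any¬)
open import Data.List.Relation.Unary.AllPairs using (_∷_)
open import Data.List.Relation.Unary.Unique.Propositional using (Unique)
open import Data.List.Relation.Unary.Unique.Propositional.Properties using (filter⁺)
import Data.List.Relation.Unary.Unique.DecPropositional as UniqueDec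
open import Relation.Nullary using (¬_; Dec; yes; no; does)
open import Relation.Nullary.Decidable using (True; from-yes; ¬?; _×-dec_; _⊎-dec_)
open import Relation.Binary.Definitions using (DecidableEquality)
open import Relation.Binary.PropositionalEquality
  using (_≡_; _≢_; refl; sym; cong; subst; subst₂)
open import Function.Bundles using (_⇔_; mk⇔)

module Exchange {A : Set} (_≟_ : DecidableEquality A) where

  open DecMembership _≟_ using (_∈?_)

  Exchange : (List A → Set) → Set
  Exchange Face = ∀ (I J : List A) → Face I → Face J →
    length I ≡ suc (length J) → ∃[ p ] (p ∈ I × p ∉ J × Face (p ∷ J))

  unique-⊆-length : ∀ {xs ys : List A} → Unique xs → xs ⊆ ys → length xs ≤ length ys
  unique-⊆-length {[]} _ _ = z≤n
  unique-⊆-length {x ∷ xs} {ys} (x∉xs ∷ uxs) xs⊆ys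
    with us , vs , refl ← ∈-∃++ (xs⊆ys (here refl)) =
    ≤-trans (s≤s (unique-⊆-length uxs xs⊆us++vs))
            (≤-reflexive (sym (length-around us)))
    where
      length-around : ∀ us → length (us ++ x ∷ vs) ≡ suc (length (us ++ vs))
      length-around []       = refl
      length-around (u ∷ us) = cong suc (length-around us)
      xs⊆us++vs : xs ⊆ us ++ vs
      xs⊆us++vs {a} a∈xs with ∈-++⁻ us (xs⊆ys (there a∈xs))
      ... | inj₁ a∈us          = ∈-++⁺ˡ a∈us
      ... | inj₂ (here refl)   = ⊥-elim (All.lookup x∉xs a∈xs refl)
      ... | inj₂ (there a∈vs)  = ∈-++⁺ʳ us a∈vs

  new-element : ∀ {I J : List A} → Unique I → length J < length I → ∃[ p ] (p ∈ I × p ∉ J)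
  new-element {I} {J} uI J<I with all? (_∈? J) I
  ... | yes I⊆J  = ⊥-elim (1+n≰n (≤-trans J<I (unique-⊆-length uI (All.lookup I⊆J))))
  ... | no  I⊈J  = find (¬All⇒Any¬ (_∈? J) I I⊈J)

  unique-∷ : ∀ {p} {J : List A} → p ∉ J → Unique J → Unique (p ∷ J)
  unique-∷ {J = J} p∉J uJ = ¬Any⇒All¬ J p∉J ∷ uJ

  ∉-∷ : ∀ {e p} {J : List A} → e ≢ p → e ∉ J → e ∉ p ∷ J
  ∉-∷ e≢p e∉J (here e≡p)  = e≢p e≡p
  ∉-∷ e≢p e∉J (there e∈J) = e∉J e∈J

  free-exchange : (Face : List A → Set) → (∀ {X} → Face X → Unique X) →
                  (∀ {X} → Unique X → Face X) → Exchange Face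
  free-exchange Face unique face I J fI fJ len
    with p , p∈I , p∉J ← new-element (unique fI) (≤-reflexive (sym len)) =
    p , p∈I , p∉J , face (unique-∷ p∉J (unique fJ))

  -- If the faces are exactly the duplicate-free lists missing some element
  -- of D, exchange holds: let I miss e₀ ∈ D and J miss e₁ ∈ D.  If e₀ ∉ J,
  -- any new element of I can be added to J (the result still misses e₀);
  -- otherwise e₀ ∷ I is longer than e₁ ∷ J, and a new element of it is an
  -- element of I outside J and different from e₁.
  avoiding-exchange : (Face : List A → Set) (D : List A) →
                      (∀ {X} → Face X → Unique X) →
                      (∀ {X} → Face X → ∃[ e ] (e ∈ D × e ∉ X)) →
                      (∀ {X e} → e ∈ D → e ∉ X → Unique X → Face X) →
                      Exchange Face
  avoiding-exchange Face D unique avoids face I J fI fJ len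
    with avoids fI | avoids fJ
  ... | e₀ , e₀∈D , e₀∉I | e₁ , e₁∈D , e₁∉J with e₀ ∈? J
  ...   | no e₀∉J
    with p , p∈I , p∉J ← new-element (unique fI) (≤-reflexive (sym len)) =
    p , p∈I , p∉J , face e₀∈D (∉-∷ (λ { refl → e₀∉I p∈I }) e₀∉J) (unique-∷ p∉J (unique fJ))
  ...   | yes e₀∈J
    with new-element {e₀ ∷ I} {e₁ ∷ J} (unique-∷ e₀∉I (unique fI))
                     (s≤s (≤-reflexive (sym len)))
  ...     | _ , here refl , p∉e₁∷J = ⊥-elim (p∉e₁∷J (there e₀∈J))
  ...     | p , there p∈I , p∉e₁∷J =
    p , p∈I , p∉J , face e₁∈D (∉-∷ (λ { refl → p∉e₁∷J (here refl) }) e₁∉J) (unique-∷ p∉J (unique fJ))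
    where
      p∉J : p ∉ J
      p∉J p∈J = p∉e₁∷J (there p∈J)

module Chains {A : Set} (_≟_ : DecidableEquality A) (_·_ : A → A → A) where

  open Exchange _≟_
  open DecMembership _≟_ using (_∈?_)

  ⟨_⟩ : List A → A → Set
  ⟨ Y ⟩ = Gen _·_ Y

  _⊆⟨_⟩ : List A → List A → Set
  C ⊆⟨ Y ⟩ = ∀ {a} → a ∈ C → ⟨ Y ⟩ a

  gen-least : ∀ {Y Z} → Z ⊆⟨ Y ⟩ → ∀ {a} → ⟨ Z ⟩ a → ⟨ Y ⟩ a
  gen-least Z⊆Y (base a∈Z) = Z⊆Y a∈Z
  gen-least Z⊆Y (mul p q)  = mul (gen-least Z⊆Y p) (gen-least Z⊆Y q)

  gen-mono : ∀ {Y Z} → Z ⊆ Y → ∀ {a} → ⟨ Z ⟩ a → ⟨ Y ⟩ a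
  gen-mono Z⊆Y = gen-least (λ a∈Z → base (Z⊆Y a∈Z))

  Chain : List A → List A → Set
  Chain acc []       = ⊤
  Chain acc (x ∷ xs) = ¬ ⟨ acc ⟩ x × Chain (acc ∷ʳ x) xs

  _⊏_ : List A → List A → Set
  Y ⊏ Z = _⊂_ _·_ ⟨ Y ⟩ ⟨ Z ⟩

  Grows : List A → List A → Set
  Grows acc L = ∀ (i : Fin (length L)) →
    (acc ++ take (toℕ i) L) ⊏ (acc ++ take (suc (toℕ i)) L)

  private
    reassociate : ∀ acc x (ys : List A) → (acc ∷ʳ x) ++ ys ≡ acc ++ x ∷ ys
    reassociate acc x ys = ++-assoc acc [ x ] ys

  chain⇒grows : ∀ acc L → Chain acc L → Grows acc L
  chain⇒grows acc (x ∷ xs) (x∉ , _) Fin.zero rewrite ++-identityʳ acc =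
    (λ _ → gen-mono ∈-++⁺ˡ) , x , base (∈-++⁺ʳ acc (here refl)) , x∉
  chain⇒grows acc (x ∷ xs) (_ , chain) (Fin.suc i) =
    subst₂ _⊏_ (reassociate acc x (take (toℕ i) xs))
               (reassociate acc x (take (suc (toℕ i)) xs))
               (chain⇒grows (acc ∷ʳ x) xs chain i)

  grows⇒chain : ∀ acc L → Grows acc L → Chain acc L
  grows⇒chain acc []       _     = tt
  grows⇒chain acc (x ∷ xs) grows = x∉ , grows⇒chain (acc ∷ʳ x) xs grows′
    where
      grows′ : Grows (acc ∷ʳ x) xs
      grows′ i = subst₂ _⊏_ (sym (reassociate acc x (take (toℕ i) xs)))
                            (sym (reassociate acc x (take (suc (toℕ i)) xs)))
                            (grows (Fin.suc i))
      x∉ : ¬ ⟨ acc ⟩ x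
      x∉ x∈ with grows Fin.zero
      ... | _ , a , a∈ , a∉ rewrite ++-identityʳ acc = a∉ (gen-least generated a∈)
        where
          generated : (acc ∷ʳ x) ⊆⟨ acc ⟩
          generated b∈ with ∈-++⁻ acc b∈
          ... | inj₁ b∈acc      = base b∈acc
          ... | inj₂ (here refl) = x∈

  chain-filter : ∀ {P : A → Set} (P? : ∀ a → Dec (P a)) {pre acc} L →
                 Chain pre L → acc ⊆ pre → Chain acc (filter P? L)
  chain-filter P? []       _             _       = tt
  chain-filter P? (x ∷ xs) (x∉ , chain) acc⊆pre with does (P? x)
  ... | true  = (λ x∈ → x∉ (gen-mono acc⊆pre x∈)) ,
                chain-filter P? xs chain (++⁺ˡ [ x ] acc⊆pre)
  ... | false = chain-filter P? xs chain (λ a∈ → ∈-++⁺ˡ (acc⊆pre a∈))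

  subset-face : ∀ {L X} → Unique L → Chain [] L → Unique X → X ⊆ L → IsFace _·_ X
  subset-face {L} {X} uL chain uX X⊆L =
    uX , M , ∼bag⇒↭ (unique∧set⇒bag (filter⁺ (_∈? X) uL) uX (mk⇔ to from)) ,
    chain⇒grows [] M (chain-filter (_∈? X) L chain (λ ()))
    where
      M : List A
      M = filter (_∈? X) L
      to : ∀ {a} → a ∈ M → a ∈ X
      to a∈M = proj₂ (∈-filter⁻ (_∈? X) {xs = L} a∈M)
      from : ∀ {a} → a ∈ X → a ∈ M
      from a∈X = ∈-filter⁺ (_∈? X) (X⊆L a∈X) a∈X

  remove : A → List A → List A
  remove s = filter (λ t → ¬? (t ≟ s))

  Redundant : List A → Set
  Redundant S = ∀ {s} → s ∈ S → ⟨ remove s S ⟩ s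

  chain-never-completes : ∀ {S} → Redundant S → ∀ acc L →
                          Chain acc L → S ⊆ acc ++ L → S ⊆ acc
  chain-never-completes red acc [] _ S⊆ = subst (_ ⊆_) (++-identityʳ acc) S⊆
  chain-never-completes {S} red acc (x ∷ xs) (x∉ , chain) S⊆ =
    drop-x (chain-never-completes red (acc ∷ʳ x) xs chain
             (subst (S ⊆_) (sym (reassociate acc x xs)) S⊆))
    where
      other : ∀ {t} → t ∈ acc ∷ʳ x → t ≢ x → t ∈ acc
      other t∈ t≢x with ∈-++⁻ acc t∈
      ... | inj₁ t∈acc       = t∈acc
      ... | inj₂ (here refl) = ⊥-elim (t≢x refl)
      drop-x : S ⊆ acc ∷ʳ x → S ⊆ acc
      drop-x S⊆acc∷ʳx with x ∈? S
      ... | yes x∈S = ⊥-elim (x∉ (gen-mono rest⊆acc (red x∈S)))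
        where
          rest⊆acc : remove x S ⊆ acc
          rest⊆acc t∈ = let t∈S , t≢x = ∈-filter⁻ (λ t → ¬? (t ≟ x)) {xs = S} t∈
                        in  other (S⊆acc∷ʳx t∈S) t≢x
      ... | no x∉S = λ s∈S → other (S⊆acc∷ʳx s∈S) (λ { refl → x∉S s∈S })

  redundant-not-face : ∀ {S X s} → Redundant S → s ∈ S → S ⊆ X → ¬ IsFace _·_ X
  redundant-not-face red s∈S S⊆X (_ , L , L↭X , grows) with
    chain-never-completes red [] L (grows⇒chain [] L grows)
      (λ t∈S → ∈-resp-↭ (↭-sym L↭X) (S⊆X t∈S)) s∈S
  ... | ()

  chain-matroid : ∀ {L} → Unique L → Chain [] L → (∀ a → a ∈ L) → IsMatroid _·_
  chain-matroid uL chain complete =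
    free-exchange (IsFace _·_) proj₁ (λ uX → subset-face uL chain uX (λ {a} _ → complete a))

  -- Cochains for a redundant set D: for each e ∈ D, everything but e is
  -- enumerated by a chain.  Then the faces are the sets missing part of D.
  Cochain : A → List A → Set
  Cochain e L = Unique L × Chain [] L × (∀ a → a ≢ e → a ∈ L)

  cochain-matroid : ∀ {d} (D : List A) → d ∈ D → Redundant D →
                    (∀ {e} → e ∈ D → ∃[ L ] Cochain e L) → IsMatroid _·_
  cochain-matroid D d∈D red cochain =
    avoiding-exchange (IsFace _·_) D proj₁ avoids face
    where
      avoids : ∀ {X} → IsFace _·_ X → ∃[ e ] (e ∈ D × e ∉ X)
      avoids {X} fX with all? (_∈? X) D
      ... | yes D⊆X = ⊥-elim (redundant-not-face red d∈D (All.lookup D⊆X) fX)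
      ... | no  D⊈X = find (¬All⇒Any¬ (_∈? X) D D⊈X)
      face : ∀ {X e} → e ∈ D → e ∉ X → Unique X → IsFace _·_ X
      face e∈D e∉X uX with cochain e∈D
      ... | L , uL , chain , complete =
        subset-face uL chain uX (λ {a} a∈X → complete a (λ { refl → e∉X a∈X }))

module Certificates {A : Set} (_≟_ : DecidableEquality A) (_·_ : A → A → A)
                    (depth : ℕ) where

  open Chains _≟_ _·_
  open DecMembership _≟_ using (_∈?_; _∉?_)

  grow : List A → List A
  grow C = deduplicate _≟_ (C ++ cartesianProductWith _·_ C C)

  closure : ℕ → List A → List A
  closure zero    C = C
  closure (suc k) C = closure k (grow C)

  closure-⊇ : ∀ k {C} → C ⊆ closure k C
  closure-⊇ zero    a∈C = a∈C
  closure-⊇ (suc k) a∈C = closure-⊇ k (∈-deduplicate⁺ _≟_ (∈-++⁺ˡ a∈C))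

  closure-sound : ∀ k {Y C} → C ⊆⟨ Y ⟩ → closure k C ⊆⟨ Y ⟩
  closure-sound zero    C⊆Y = C⊆Y
  closure-sound (suc k) {Y} {C} C⊆Y = closure-sound k grow-sound
    where
      grow-sound : grow C ⊆⟨ Y ⟩
      grow-sound a∈ with ∈-++⁻ C (∈-deduplicate⁻ _≟_ (C ++ _) a∈)
      ... | inj₁ a∈C = C⊆Y a∈C
      ... | inj₂ a∈CC with ∈-cartesianProductWith⁻ _·_ C C a∈CC
      ...   | b , c , b∈C , c∈C , refl = mul (C⊆Y b∈C) (C⊆Y c∈C)

  Closed : List A → Set
  Closed C = All (λ a → All (λ b → (a · b) ∈ C) C) C

  closed? : ∀ C → Dec (Closed C)
  closed? C = all? (λ a → all? (λ b → (a · b) ∈? C) C) C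

  closed-contains : ∀ {Y C} → Y ⊆ C → Closed C → ∀ {a} → ⟨ Y ⟩ a → a ∈ C
  closed-contains Y⊆C closed (base a∈Y) = Y⊆C a∈Y
  closed-contains Y⊆C closed (mul p q) =
    All.lookup (All.lookup closed (closed-contains Y⊆C closed p))
               (closed-contains Y⊆C closed q)

  Outside : List A → A → Set
  Outside Y x = Closed (closure depth Y) × x ∉ closure depth Y

  outside? : ∀ Y x → Dec (Outside Y x)
  outside? Y x = closed? (closure depth Y) ×-dec (x ∉? closure depth Y)

  outside-sound : ∀ {Y x} → Outside Y x → ¬ ⟨ Y ⟩ x
  outside-sound (closed , x∉) x∈ = x∉ (closed-contains (closure-⊇ depth) closed x∈)

  ChainCert : List A → List A → Set
  ChainCert acc []       = ⊤
  ChainCert acc (x ∷ xs) = Outside acc x × ChainCert (acc ∷ʳ x) xs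

  chainCert? : ∀ acc L → Dec (ChainCert acc L)
  chainCert? acc []       = yes tt
  chainCert? acc (x ∷ xs) = outside? acc x ×-dec chainCert? (acc ∷ʳ x) xs

  chainCert-sound : ∀ acc L → ChainCert acc L → Chain acc L
  chainCert-sound acc []       _             = tt
  chainCert-sound acc (x ∷ xs) (out , cert) =
    outside-sound out , chainCert-sound (acc ∷ʳ x) xs cert

  RedundantCert : List A → Set
  RedundantCert S = All (λ s → s ∈ closure depth (remove s S)) S

  redundantCert? : ∀ S → Dec (RedundantCert S)
  redundantCert? S = all? (λ s → s ∈? closure depth (remove s S)) S

  redundant-sound : ∀ {S} → RedundantCert S → Redundant S
  redundant-sound cert s∈S = closure-sound depth base (All.lookup cert s∈S)

  FaceCert : List A → Set
  FaceCert L = Unique L × ChainCert [] L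

  faceCert? : ∀ L → Dec (FaceCert L)
  faceCert? L = UniqueDec.unique? _≟_ L ×-dec chainCert? [] L

  faceCert-sound : ∀ {L} → FaceCert L → IsFace _·_ L
  faceCert-sound {L} (uL , cert) =
    uL , L , ↭-refl , chain⇒grows [] L (chainCert-sound [] L cert)

_≟B_ : ∀ {n} → DecidableEquality (BElt n)
_≟B_ = Maybe.≡-dec (Product.≡-dec Fin._≟_ Fin._≟_)

elements : ∀ n → List (BElt n)
elements n = nothing ∷ map just (cartesianProduct (allFin n) (allFin n))

elements-complete : ∀ {n} (x : BElt n) → x ∈ elements n
elements-complete nothing        = here refl
elements-complete (just (i , j)) =
  there (∈-map⁺ just (∈-cartesianProduct⁺ (∈-allFin i) (∈-allFin j)))

E : ∀ {n} (i j : ℕ) {i<n : True (i <? n)} {j<n : True (j <? n)} → BElt n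
E i j {i<n} {j<n} = just ((# i) {m<n = i<n} , (# j) {m<n = j<n})

module Brandt (n : ℕ) where

  -- Two rounds of closing under products suffice for every certificate
  -- checked below.
  open Chains (_≟B_ {n}) bmul public
  open Certificates (_≟B_ {n}) bmul 2 public
  open DecMembership (_≟B_ {n}) using (_∈?_)

  SpanningChain : List (BElt n) → Set
  SpanningChain L = FaceCert L × All (_∈ L) (elements n)

  spanningChain? : ∀ L → Dec (SpanningChain L)
  spanningChain? L = faceCert? L ×-dec all? (_∈? L) (elements n)

  spanning-matroid : ∀ {L} → SpanningChain L → HBIsMatroid n
  spanning-matroid {L} ((uL , cert) , covers) =
    chain-matroid uL (chainCert-sound [] L cert)
      (λ a → All.lookup covers (elements-complete a))

  CochainCert : BElt n × List (BElt n) → Set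
  CochainCert (e , L) = FaceCert L × All (λ a → a ≡ e ⊎ a ∈ L) (elements n)

  cochainCert? : ∀ eL → Dec (CochainCert eL)
  cochainCert? (e , L) =
    faceCert? L ×-dec all? (λ a → (a ≟B e) ⊎-dec (a ∈? L)) (elements n)

  cochain-table-matroid : ∀ (T : List (BElt n × List (BElt n))) {t} → t ∈ T →
                          RedundantCert (map proj₁ T) → All CochainCert T →
                          HBIsMatroid n
  cochain-table-matroid T t∈T redundant certs =
    cochain-matroid (map proj₁ T) (∈-map⁺ proj₁ t∈T) (redundant-sound redundant) cochain
    where
      cochain : ∀ {e} → e ∈ map proj₁ T → ∃[ L ] Cochain e L
      cochain e∈D with (e , L) , eL∈T , refl ← ∈-map⁻ proj₁ e∈D
        with (uL , cert) , covers ← All.lookup certs eL∈T =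
        L , uL , chainCert-sound [] L cert , covered
        where
          covered : ∀ a → a ≢ e → a ∈ L
          covered a a≢e with All.lookup covers (elements-complete a)
          ... | inj₁ a≡e = ⊥-elim (a≢e a≡e)
          ... | inj₂ a∈L = a∈L

B1-matroid : HBIsMatroid 1
B1-matroid = spanning-matroid (from-yes (spanningChain? (nothing ∷ E 0 0 ∷ [])))
  where open Brandt 1

B2-matroid : HBIsMatroid 2
B2-matroid = spanning-matroid (from-yes (spanningChain?
  (nothing ∷ E 0 0 ∷ E 1 1 ∷ E 0 1 ∷ E 1 0 ∷ [])))
  where open Brandt 2

-- For n = 3 the off-diagonal elements are redundant, and removing any one
-- of them leaves a chain.
B3-matroid : HBIsMatroid 3
B3-matroid = cochain-table-matroid cochains (here refl)
  (from-yes (redundantCert? (map proj₁ cochains)))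
  (from-yes (all? cochainCert? cochains))
  where
    open Brandt 3
    withIdempotents : List (BElt 3) → List (BElt 3)
    withIdempotents L = nothing ∷ E 0 0 ∷ E 1 1 ∷ E 2 2 ∷ L
    cochains : List (BElt 3 × List (BElt 3))
    cochains =
      (E 0 1 , withIdempotents (E 0 2 ∷ E 1 2 ∷ E 1 0 ∷ E 2 0 ∷ E 2 1 ∷ [])) ∷
      (E 0 2 , withIdempotents (E 0 1 ∷ E 2 1 ∷ E 2 0 ∷ E 1 0 ∷ E 1 2 ∷ [])) ∷
      (E 1 0 , withIdempotents (E 0 1 ∷ E 0 2 ∷ E 1 2 ∷ E 2 1 ∷ E 2 0 ∷ [])) ∷
      (E 1 2 , withIdempotents (E 0 1 ∷ E 0 2 ∷ E 2 1 ∷ E 2 0 ∷ E 1 0 ∷ [])) ∷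
      (E 2 0 , withIdempotents (E 0 1 ∷ E 0 2 ∷ E 1 2 ∷ E 1 0 ∷ E 2 1 ∷ [])) ∷
      (E 2 1 , withIdempotents (E 0 1 ∷ E 0 2 ∷ E 1 2 ∷ E 1 0 ∷ E 2 0 ∷ [])) ∷ []

-- For n ≥ 4 exchange fails for the faces I, J below (|I| = |J| + 1):
-- the elements of I outside J are (3,2) and (3,1), and adding either to J
-- yields a redundant set.
module Counterexample (m : ℕ) where

  N : ℕ
  N = suc (suc (suc (suc m)))

  open Brandt N
  open DecMembership (_≟B_ {N}) using (_∈?_)

  J I : List (BElt N)
  J = E 0 1 ∷ E 0 2 ∷ E 0 3 ∷ E 1 2 ∷ E 1 3 ∷ E 2 1 ∷ E 2 0 ∷ E 3 0 ∷ []
  I = E 0 1 ∷ E 0 2 ∷ E 0 3 ∷ E 1 2 ∷ E 1 3 ∷ E 3 2 ∷ E 3 1 ∷ E 2 1 ∷ E 2 0 ∷ []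

  J-face : IsFace bmul J
  J-face = faceCert-sound (from-yes (faceCert? J))

  I-face : IsFace bmul I
  I-face = faceCert-sound (from-yes (faceCert? I))

  I-blocked : All (λ p → p ∈ J ⊎ RedundantCert (p ∷ J)) I
  I-blocked = from-yes (all? (λ p → (p ∈? J) ⊎-dec redundantCert? (p ∷ J)) I)

  stuck : ∀ {p} → p ∈ J ⊎ RedundantCert (p ∷ J) → p ∉ J → ¬ IsFace bmul (p ∷ J)
  stuck (inj₁ p∈J)       p∉J = λ _ → p∉J p∈J
  stuck (inj₂ redundant) _   = redundant-not-face (redundant-sound redundant) (here refl) (λ q → q)

  not-matroid : ¬ HBIsMatroid N
  not-matroid matroid =
    let p , p∈I , p∉J , p∷J-face = matroid I J I-face J-face refl
    in  stuck (All.lookup I-blocked p∈I) p∉J p∷J-face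

proposition5p17 : ∀ (n : ℕ) → 1 ≤ n → (HBIsMatroid n ⇔ n ≤ 3)
proposition5p17 (suc zero)             _ = mk⇔ (λ _ → s≤s z≤n) (λ _ → B1-matroid)
proposition5p17 (suc (suc zero))       _ = mk⇔ (λ _ → s≤s (s≤s z≤n)) (λ _ → B2-matroid)
proposition5p17 (suc (suc (suc zero))) _ =
  mk⇔ (λ _ → s≤s (s≤s (s≤s z≤n))) (λ _ → B3-matroid)
proposition5p17 (suc (suc (suc (suc m)))) _ =
  mk⇔ (λ matroid → ⊥-elim (Counterexample.not-matroid m matroid))
      (λ { (s≤s (s≤s (s≤s ()))) })
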